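{- Let $\mathbb F$ be a field and $a\in\mathbb F$. The graph parameter $\operatorname{wm}_a$, as a function on simple graphs, is not expressible as a graph homomorphism function over $\mathbb F$; that is, there is no $\mathbb F$-weighted graph $H$ such that $\operatorname{wm}_a(G)=\hom(G,H)$ for every simple graph $G$.
   Context: For a graph $G$, $\operatorname{wm}_a(G)=\sum_{M}a^{|V(G)|-2|M|}$, the sum over all matchings $M$ of $G$ (including the empty matching), i.e. each vertex not covered by $M$ contributes a factor $a$, with the convention $a^0=1$ even if $a=0$. (Thus $\operatorname{wm}_0$ counts perfect matchings in $\mathbb F$, and $\operatorname{wm}_1$ counts all matchings.) An $\mathbb F$-weighted graph $H$ is given by $q=|V(H)|\ge0$, vertex weights $\alpha_1,\dots,\alpha_q\in\mathbb F\setminus\{0\}$ and a symmetric matrix $B=(\beta_{ij})\in\mathbb F^{q\times q}$; $\hom(G,H)=\sum_{\phi:V(G)\to[q]}\prod_{u\in V(G)}\alpha_{\phi(u)}\prod_{uv\in E(G)}\beta_{\phi(u)\phi(v)}$ (empty products equal $1$). -}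

module Defs where

open import Level using (Level; _⊔_; suc)
open import Algebra.Bundles using (CommutativeRing)
open import Data.Bool using (Bool; true; false; if_then_else_; _∧_; not)
open import Data.Nat as ℕ using (ℕ; zero; _∸_; _<ᵇ_)
import Data.Nat
open import Data.Fin using (Fin; toℕ) renaming (zero to fzero; suc to fsuc)
open import Data.List using (List; []; _∷_; map; concatMap; foldr; length; filter)
open import Data.Product using (Σ; _,_)
open import Data.Nat.ListAction using () renaming (sum to sumℕ)
open import Relation.Nullary using (¬_)
open import Relation.Binary.PropositionalEquality using (_≡_)

record Field (c ℓ : Level) : Set (Level.suc (c ⊔ ℓ)) where
  field
    commutativeRing : CommutativeRing c ℓ
  open CommutativeRing commutativeRing public
  field
    1≉0     : ¬ (1# ≈ 0#)
    inverse : ∀ x → ¬ (x ≈ 0#) → Σ Carrier (λ y → (x * y) ≈ 1#)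

-- Finite simple graphs on vertex set Fin n: symmetric irreflexive
-- Boolean adjacency.  The edges are the pairs {u,v} with u < v and adj u v.

record SimpleGraph : Set where
  field
    n      : ℕ
    adj    : Fin n → Fin n → Bool
    sym    : ∀ u v → adj u v ≡ adj v u
    irrefl : ∀ u → adj u u ≡ false
open SimpleGraph public

allFin : (k : ℕ) → List (Fin k)
allFin zero    = []
allFin (ℕ.suc k) = fzero ∷ map fsuc (allFin k)

consF : ∀ {a} {A : Set a} {k : ℕ} → A → (Fin k → A) → (Fin (ℕ.suc k) → A)
consF x f fzero    = x
consF x f (fsuc i) = f i

allFuns : ∀ {a} {A : Set a} (k : ℕ) → List A → List (Fin k → A)
allFuns zero    xs = (λ ()) ∷ []
allFuns (ℕ.suc k) xs = concatMap (λ x → map (consF x) (allFuns k xs)) xs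

allBool : List Bool
allBool = false ∷ true ∷ []

allᵇ : ∀ {a} {A : Set a} → (A → Bool) → List A → Bool
allᵇ p = foldr (λ x b → p x ∧ b) true

countᵇ : ∀ {a} {A : Set a} → (A → Bool) → List A → ℕ
countᵇ p xs = length (filter (λ x → Data.Bool.T? (p x)) xs)
  where import Data.Bool

_<ꟳ_ : ∀ {k} → Fin k → Fin k → Bool
u <ꟳ v = toℕ u <ᵇ toℕ v

_≡ꟳ_ : ∀ {k} → Fin k → Fin k → Bool
u ≡ꟳ v = toℕ u Data.Nat.≡ᵇ toℕ v

-- A candidate M is a Boolean matrix Fin n → Fin n → Bool;
-- it encodes a matching of G iff it is symmetric, every M-pair is an edge
-- of G, and no vertex lies in two different M-pairs.  Each matching of G
-- corresponds to exactly one such matrix.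

module _ (G : SimpleGraph) where
  private
    V = allFin (n G)

  isMatching : (Fin (n G) → Fin (n G) → Bool) → Bool
  isMatching M =
    allᵇ (λ u → allᵇ (λ v →
        (not (M u v) Data.Bool.∨ (M v u ∧ adj G u v))
      ∧ allᵇ (λ w → not (M u v ∧ M u w) Data.Bool.∨ (v ≡ꟳ w)) V) V) V

  matchings : List (Fin (n G) → Fin (n G) → Bool)
  matchings = filter (λ M → Data.Bool.T? (isMatching M))
                     (allFuns (n G) (allFuns (n G) allBool))

  matchingSize : (Fin (n G) → Fin (n G) → Bool) → ℕ
  matchingSize M = sumℕ (map (λ u → countᵇ (λ v → (u <ꟳ v) ∧ M u v) V) V)

module _ {c ℓ} (F : Field c ℓ) where
  open Field F

  sumL : ∀ {a} {A : Set a} → (A → Carrier) → List A → Carrier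
  sumL f = foldr (λ x s → f x + s) 0#

  prodL : ∀ {a} {A : Set a} → (A → Carrier) → List A → Carrier
  prodL f = foldr (λ x s → f x * s) 1#

  -- a ^ k with a ^ 0 = 1 (also for a = 0)
  pow : Carrier → ℕ → Carrier
  pow a zero      = 1#
  pow a (ℕ.suc k) = a * pow a k

  wm : Carrier → SimpleGraph → Carrier
  wm a G = sumL (λ M → pow a (n G ∸ 2 Data.Nat.* matchingSize G M)) (matchings G)

  record WeightedGraph : Set (c ⊔ ℓ) where
    field
      q       : ℕ
      α       : Fin q → Carrier
      α≉0     : ∀ i → ¬ (α i ≈ 0#)
      β       : Fin q → Fin q → Carrier
      β-sym   : ∀ i j → β i j ≈ β j i

  hom : SimpleGraph → WeightedGraph → Carrier
  hom G H = sumL (λ φ →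
        prodL (λ u → WeightedGraph.α H (φ u)) V
      * prodL (λ u → prodL (λ v →
            if (u <ꟳ v) ∧ adj G u v then WeightedGraph.β H (φ u) (φ v) else 1#) V) V)
    (allFuns (n G) (allFin (WeightedGraph.q H)))
    where V = allFin (n G)

module Submission where

-- Suppose wm_a(G) = hom(G, H) for every simple graph G, where H has
-- vertex weights α_i and edge weights β_ij.  We only evaluate both sides
-- on the stars K_{1,m}.  Sending the centre to i and each leaf
-- independently gives hom(K_{1,m}, H) = ∑_i α_i d_i^m with
-- d_i = ∑_j α_j β_ij, while a matching of K_{1,m} is empty or a single
-- edge, so wm_a(K_{1,m}) = a^{m+1} + m·a^{m-1}.  Taking linear
-- combinations of these power sums, every polynomial p satisfies
-- ∑_i α_i p(d_i) = a·p(a) + p′(a); so p ↦ p′(a) would be a finite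
-- combination of point evaluations, which fails over a field.

open import Defs hiding (sym)
open import Level using (Level)
open import Algebra.Bundles using (CommutativeSemiring; CommutativeRing)
open import Data.Bool using (Bool; true; false; if_then_else_; _∧_; _∨_; not; T; T?)
open import Data.Bool.Properties using (T-∧; ∧-zeroʳ; if-∧)
open import Data.Empty using (⊥-elim)
open import Data.Fin using (Fin; toℕ) renaming (zero to fzero; suc to fsuc)
open import Data.Fin.Properties using (toℕ-injective; suc-injective)
open import Data.List using (List; []; _∷_; map; concatMap; filter; _++_; foldr)
open import Data.List.Properties using (map-cong)
open import Data.Nat using (ℕ; zero; suc; _∸_)
import Data.Nat as ℕ
import Data.Nat.Properties as ℕₚ
open import Data.Nat.ListAction using (sum)
open import Data.Product using (Σ; _,_; proj₁; proj₂; _×_)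
open import Data.Unit using (tt)
open import Function.Bundles using (Equivalence)
open import Relation.Nullary using (¬_; yes; no)
open import Relation.Nullary.Decidable.Core using (¬¬-excluded-middle)
open import Relation.Binary.PropositionalEquality as ≡ using (_≡_)

∧-fst : ∀ {x y} → T (x ∧ y) → T x
∧-fst {x} t = proj₁ (Equivalence.to (T-∧ {x}) t)

∧-snd : ∀ {x y} → T (x ∧ y) → T y
∧-snd {x} t = proj₂ (Equivalence.to (T-∧ {x}) t)

∧-pair : ∀ {x y} → T x → T y → T (x ∧ y)
∧-pair {x} p q = Equivalence.from (T-∧ {x}) (p , q)

⇒ᵇ-elim : ∀ {x y} → T (not x ∨ y) → T x → T y
⇒ᵇ-elim {true} t _ = t

⇒ᵇ-intro : ∀ x {y} → (T x → T y) → T (not x ∨ y)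
⇒ᵇ-intro true  f = f tt
⇒ᵇ-intro false f = tt

T-ext : ∀ {x y} → (T x → T y) → (T y → T x) → x ≡ y
T-ext {false} {false} _ _ = ≡.refl
T-ext {false} {true}  _ g = ⊥-elim (g tt)
T-ext {true}  {false} f _ = ⊥-elim (f tt)
T-ext {true}  {true}  _ _ = ≡.refl

allᵇ-map : ∀ {A B : Set} (p : B → Bool) (f : A → B) (xs : List A) →
           allᵇ p (map f xs) ≡ allᵇ (λ x → p (f x)) xs
allᵇ-map p f []       = ≡.refl
allᵇ-map p f (x ∷ xs) = ≡.cong (p (f x) ∧_) (allᵇ-map p f xs)

allᵇ-elim : ∀ {k} (p : Fin k → Bool) → T (allᵇ p (allFin k)) → ∀ i → T (p i)
allᵇ-elim p t fzero    = ∧-fst t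
allᵇ-elim {suc k} p t (fsuc i) =
  allᵇ-elim (λ j → p (fsuc j)) (≡.subst T (allᵇ-map p fsuc (allFin k)) (∧-snd t)) i

allᵇ-intro : ∀ {k} (p : Fin k → Bool) → (∀ i → T (p i)) → T (allᵇ p (allFin k))
allᵇ-intro {zero}  p h = tt
allᵇ-intro {suc k} p h =
  ∧-pair (h fzero) (≡.subst T (≡.sym (allᵇ-map p fsuc (allFin k))) (allᵇ-intro _ (λ i → h (fsuc i))))

-- These decide equality of rows and of Boolean matrices, which
-- is what lets us sum over "all matrices equal to a given one".

_==_ : Bool → Bool → Bool
true  == y = y
false == y = not y

==-refl : ∀ x → T (x == x)
==-refl true  = tt
==-refl false = tt

==-elim : ∀ {x y} → T (x == y) → x ≡ y
==-elim {true}  {true}  _ = ≡.refl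
==-elim {false} {false} _ = ≡.refl

==-intro : ∀ {x y} → x ≡ y → T (x == y)
==-intro {x} ≡.refl = ==-refl x

pointwise : ∀ {A : Set} {k} → (A → A → Bool) → (Fin k → A) → (Fin k → A) → Bool
pointwise {k = zero}  E f g = true
pointwise {k = suc k} E f g = E (f fzero) (g fzero) ∧ pointwise E (λ i → f (fsuc i)) (λ i → g (fsuc i))

pointwise-elim : ∀ {A : Set} {k} (E : A → A → Bool) (f g : Fin k → A) →
                 T (pointwise E f g) → ∀ i → T (E (f i) (g i))
pointwise-elim E f g t fzero    = ∧-fst t
pointwise-elim E f g t (fsuc i) = pointwise-elim E _ _ (∧-snd {E (f fzero) (g fzero)} t) i

pointwise-intro : ∀ {A : Set} {k} (E : A → A → Bool) (f g : Fin k → A) →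
                  (∀ i → T (E (f i) (g i))) → T (pointwise E f g)
pointwise-intro {k = zero}  E f g h = tt
pointwise-intro {k = suc k} E f g h = ∧-pair (h fzero) (pointwise-intro E _ _ (λ i → h (fsuc i)))

pointwise-refl : ∀ {A : Set} {k} (E : A → A → Bool) → (∀ x → T (E x x)) →
                 (f : Fin k → A) → T (pointwise E f f)
pointwise-refl E E-refl f = pointwise-intro E f f (λ i → E-refl (f i))

sameRow : ∀ {k} → (Fin k → Bool) → (Fin k → Bool) → Bool
sameRow = pointwise _==_

sameMatrix : ∀ {k m} → (Fin k → Fin m → Bool) → (Fin k → Fin m → Bool) → Bool
sameMatrix = pointwise sameRow

sameRow-elim : ∀ {k} (r s : Fin k → Bool) → T (sameRow r s) → ∀ i → r i ≡ s i
sameRow-elim r s t i = ==-elim (pointwise-elim _==_ r s t i)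

sameRow-intro : ∀ {k} (r s : Fin k → Bool) → (∀ i → r i ≡ s i) → T (sameRow r s)
sameRow-intro r s h = pointwise-intro _==_ r s (λ i → ==-intro (h i))

sameMatrix-elim : ∀ {k m} (M N : Fin k → Fin m → Bool) → T (sameMatrix M N) → ∀ u v → M u v ≡ N u v
sameMatrix-elim M N t u = sameRow-elim (M u) (N u) (pointwise-elim sameRow M N t u)

sameMatrix-intro : ∀ {k m} (M N : Fin k → Fin m → Bool) → (∀ u v → M u v ≡ N u v) → T (sameMatrix M N)
sameMatrix-intro M N h = pointwise-intro sameRow M N (λ u → sameRow-intro (M u) (N u) (h u))

noneᵇ : ∀ {k} → (Fin k → Bool) → Bool
noneᵇ {zero}  r = true
noneᵇ {suc k} r = not (r fzero) ∧ noneᵇ (λ i → r (fsuc i))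

atMostOne : ∀ {k} → (Fin k → Bool) → Bool
atMostOne {zero}  r = true
atMostOne {suc k} r = if r fzero then noneᵇ (λ i → r (fsuc i)) else atMostOne (λ i → r (fsuc i))

count : ∀ {k} → (Fin k → Bool) → ℕ
count {zero}  r = 0
count {suc k} r = (if r fzero then 1 else 0) ℕ.+ count (λ i → r (fsuc i))

Rows : (k : ℕ) → List (Fin k → Bool)
Rows k = allFuns k allBool

noneᵇ-elim : ∀ {k} (r : Fin k → Bool) → T (noneᵇ r) → ∀ i → ¬ T (r i)
noneᵇ-elim r t fzero    r₀ with r fzero
noneᵇ-elim r () fzero tt | true
noneᵇ-elim r t (fsuc i) = noneᵇ-elim _ (∧-snd {not (r fzero)} t) i

noneᵇ-intro : ∀ {k} (r : Fin k → Bool) → (∀ i → ¬ T (r i)) → T (noneᵇ r)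
noneᵇ-intro {zero}  r h = tt
noneᵇ-intro {suc k} r h with r fzero | h fzero
... | true  | ¬r₀ = ¬r₀ tt
... | false | _   = noneᵇ-intro _ (λ i → h (fsuc i))

atMostOne-elim : ∀ {k} (r : Fin k → Bool) → T (atMostOne r) → ∀ i j → T (r i) → T (r j) → i ≡ j
atMostOne-elim {suc k} r t i j ri rj with r fzero in r₀
... | true  = headTrue i j ri rj
  where
  headTrue : ∀ i j → T (r i) → T (r j) → i ≡ j
  headTrue fzero    fzero    _  _  = ≡.refl
  headTrue fzero    (fsuc j) _  rj = ⊥-elim (noneᵇ-elim _ t j rj)
  headTrue (fsuc i) _        ri _  = ⊥-elim (noneᵇ-elim _ t i ri)
... | false = headFalse i j ri rj
  where
  headFalse : ∀ i j → T (r i) → T (r j) → i ≡ j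
  headFalse fzero    _        ri _  = ⊥-elim (≡.subst T r₀ ri)
  headFalse (fsuc i) fzero    _  rj = ⊥-elim (≡.subst T r₀ rj)
  headFalse (fsuc i) (fsuc j) ri rj = ≡.cong fsuc (atMostOne-elim _ t i j ri rj)

atMostOne-intro : ∀ {k} (r : Fin k → Bool) → (∀ i j → T (r i) → T (r j) → i ≡ j) → T (atMostOne r)
atMostOne-intro {zero}  r h = tt
atMostOne-intro {suc k} r h with r fzero in r₀
... | true  = noneᵇ-intro _ (λ j rj → centreClash (h fzero (fsuc j) (≡.subst T (≡.sym r₀) tt) rj))
  where
  centreClash : ∀ {j : Fin k} → ¬ (fzero ≡ fsuc j)
  centreClash ()
... | false = atMostOne-intro _ (λ i j ri rj → suc-injective (h (fsuc i) (fsuc j) ri rj))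

atMostOne-cong : ∀ {k} (r s : Fin k → Bool) → (∀ i → r i ≡ s i) → atMostOne r ≡ atMostOne s
atMostOne-cong r s r≗s = T-ext
  (λ t → atMostOne-intro s (λ i j si sj → atMostOne-elim r t i j (toR i si) (toR j sj)))
  (λ t → atMostOne-intro r (λ i j ri rj → atMostOne-elim s t i j (toS i ri) (toS j rj)))
  where
  toR : ∀ i → T (s i) → T (r i)
  toR i = ≡.subst T (≡.sym (r≗s i))
  toS : ∀ i → T (r i) → T (s i)
  toS i = ≡.subst T (r≗s i)

IsMatching : (G : SimpleGraph) → (Fin (n G) → Fin (n G) → Bool) → Set
IsMatching G M = (∀ u v → T (M u v) → T (M v u) × T (adj G u v))
               × (∀ u v w → T (M u v) → T (M u w) → v ≡ w)

isMatching-sound : ∀ G M → T (isMatching G M) → IsMatching G M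
isMatching-sound G M t = paired , functional
  where
  atPair : ∀ u v → T ((not (M u v) ∨ (M v u ∧ adj G u v))
                      ∧ allᵇ (λ w → not (M u v ∧ M u w) ∨ (v ≡ꟳ w)) (allFin (n G)))
  atPair u v = allᵇ-elim _ (allᵇ-elim _ t u) v
  paired : ∀ u v → T (M u v) → T (M v u) × T (adj G u v)
  paired u v m = let e = ⇒ᵇ-elim (∧-fst (atPair u v)) m in ∧-fst e , ∧-snd e
  functional : ∀ u v w → T (M u v) → T (M u w) → v ≡ w
  functional u v w m m′ = toℕ-injective (ℕₚ.≡ᵇ⇒≡ _ _
    (⇒ᵇ-elim (allᵇ-elim _ (∧-snd {not (M u v) ∨ (M v u ∧ adj G u v)} (atPair u v)) w) (∧-pair m m′)))

isMatching-complete : ∀ G M → IsMatching G M → T (isMatching G M)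
isMatching-complete G M (paired , functional) =
  allᵇ-intro _ λ u → allᵇ-intro _ λ v → ∧-pair
    (⇒ᵇ-intro (M u v) (λ m → ∧-pair (proj₁ (paired u v m)) (proj₂ (paired u v m))))
    (allᵇ-intro _ λ w → ⇒ᵇ-intro (M u v ∧ M u w)
      (λ mm → ℕₚ.≡⇒≡ᵇ _ _ (≡.cong toℕ (functional u v w (∧-fst mm) (∧-snd {M u v} mm)))))

IsMatching-resp : ∀ G M N → (∀ u v → M u v ≡ N u v) → IsMatching G M → IsMatching G N
IsMatching-resp G M N M≗N (paired , functional) =
    (λ u v m → let p = paired u v (fromN u v m) in toN v u (proj₁ p) , proj₂ p)
  , (λ u v w m m′ → functional u v w (fromN u v m) (fromN u w m′))
  where
  toN : ∀ u v → T (M u v) → T (N u v)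
  toN u v = ≡.subst T (M≗N u v)
  fromN : ∀ u v → T (N u v) → T (M u v)
  fromN u v = ≡.subst T (≡.sym (M≗N u v))

starAdj : ∀ {k} → Fin (suc k) → Fin (suc k) → Bool
starAdj fzero    fzero    = false
starAdj fzero    (fsuc _) = true
starAdj (fsuc _) fzero    = true
starAdj (fsuc _) (fsuc _) = false

starAdj-sym : ∀ {k} (u v : Fin (suc k)) → starAdj u v ≡ starAdj v u
starAdj-sym fzero    fzero    = ≡.refl
starAdj-sym fzero    (fsuc _) = ≡.refl
starAdj-sym (fsuc _) fzero    = ≡.refl
starAdj-sym (fsuc _) (fsuc _) = ≡.refl

starAdj-irrefl : ∀ {k} (u : Fin (suc k)) → starAdj u u ≡ false
starAdj-irrefl fzero    = ≡.refl
starAdj-irrefl (fsuc _) = ≡.refl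

star : ℕ → SimpleGraph
star k = record { n = suc k ; adj = starAdj ; sym = starAdj-sym ; irrefl = starAdj-irrefl }

StarMatrix : ℕ → Set
StarMatrix k = Fin (suc k) → Fin (suc k) → Bool

starMatching : ∀ {k} → (Fin k → Bool) → StarMatrix k
starMatching r fzero    fzero    = false
starMatching r fzero    (fsuc j) = r j
starMatching r (fsuc i) fzero    = r i
starMatching r (fsuc i) (fsuc j) = false

centreRow : ∀ {k} → StarMatrix k → Fin k → Bool
centreRow M j = M fzero (fsuc j)

starMatching-cong : ∀ {k} (r s : Fin k → Bool) → (∀ i → r i ≡ s i) →
                    ∀ u v → starMatching r u v ≡ starMatching s u v
starMatching-cong r s r≗s fzero    fzero    = ≡.refl
starMatching-cong r s r≗s fzero    (fsuc j) = r≗s j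
starMatching-cong r s r≗s (fsuc i) fzero    = r≗s i
starMatching-cong r s r≗s (fsuc i) (fsuc j) = ≡.refl

starMatching-shape : ∀ {k} (M : StarMatrix k) → IsMatching (star k) M →
                     (∀ u v → M u v ≡ starMatching (centreRow M) u v) × T (atMostOne (centreRow M))
starMatching-shape M (paired , functional) =
  entries , atMostOne-intro _ (λ i j mi mj → suc-injective (functional fzero (fsuc i) (fsuc j) mi mj))
  where
  entries : ∀ u v → M u v ≡ starMatching (centreRow M) u v
  entries fzero    fzero    = T-ext (λ m → proj₂ (paired fzero fzero m)) (λ ())
  entries fzero    (fsuc j) = ≡.refl
  entries (fsuc i) fzero    = T-ext (λ m → proj₁ (paired _ _ m)) (λ m → proj₁ (paired _ _ m))
  entries (fsuc i) (fsuc j) = T-ext (λ m → proj₂ (paired (fsuc i) (fsuc j) m)) (λ ())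

starMatching-isMatching : ∀ {k} (r : Fin k → Bool) → T (atMostOne r) → IsMatching (star k) (starMatching r)
starMatching-isMatching r t = paired , functional
  where
  paired : ∀ u v → T (starMatching r u v) → T (starMatching r v u) × T (starAdj u v)
  paired fzero    (fsuc j) m = m , tt
  paired (fsuc i) fzero    m = m , tt
  functional : ∀ u v w → T (starMatching r u v) → T (starMatching r u w) → v ≡ w
  functional fzero    (fsuc j) (fsuc j′) m m′ = ≡.cong fsuc (atMostOne-elim r t j j′ m m′)
  functional (fsuc i) fzero    fzero     _ _  = ≡.refl

isMatching-star : ∀ k (M : StarMatrix k) →
  isMatching (star k) M ≡ (sameMatrix M (starMatching (centreRow M)) ∧ atMostOne (centreRow M))
isMatching-star k M = T-ext
  (λ t → let (entries , one) = starMatching-shape M (isMatching-sound (star k) M t)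
         in ∧-pair (sameMatrix-intro M _ entries) one)
  (λ t → isMatching-complete (star k) M
           (IsMatching-resp (star k) S M (λ u v → ≡.sym (sameMatrix-elim M S (∧-fst t) u v))
             (starMatching-isMatching (centreRow M) (∧-snd {sameMatrix M S} t))))
  where
  S : StarMatrix k
  S = starMatching (centreRow M)

sameMatrix-starMatching : ∀ {k} (M : StarMatrix k) (r : Fin k → Bool) →
  sameMatrix M (starMatching r) ≡ (sameRow r (centreRow M) ∧ sameMatrix M (starMatching (centreRow M)))
sameMatrix-starMatching M r = T-ext
  (λ t → let M≗ = sameMatrix-elim M (starMatching r) t
             r≗ : ∀ j → r j ≡ centreRow M j
             r≗ j = ≡.sym (M≗ fzero (fsuc j))
         in ∧-pair (sameRow-intro r (centreRow M) r≗)
                   (sameMatrix-intro M _ (λ u v → ≡.trans (M≗ u v) (starMatching-cong r _ r≗ u v))))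
  (λ t → let r≗ = sameRow-elim r (centreRow M) (∧-fst t)
             M≗ = sameMatrix-elim M _ (∧-snd {sameRow r (centreRow M)} t)
         in sameMatrix-intro M (starMatching r)
              (λ u v → ≡.trans (M≗ u v) (≡.sym (starMatching-cong r _ r≗ u v))))

countᵇ-∷ : ∀ {A : Set} (p : A → Bool) x xs → countᵇ p (x ∷ xs) ≡ (if p x then 1 else 0) ℕ.+ countᵇ p xs
countᵇ-∷ p x xs with p x
... | true  = ≡.refl
... | false = ≡.refl

countᵇ-cong : ∀ {A : Set} (p q : A → Bool) → (∀ x → p x ≡ q x) → ∀ xs → countᵇ p xs ≡ countᵇ q xs
countᵇ-cong p q p≗q []       = ≡.refl
countᵇ-cong p q p≗q (x ∷ xs) = begin
  countᵇ p (x ∷ xs)                        ≡⟨ countᵇ-∷ p x xs ⟩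
  (if p x then 1 else 0) ℕ.+ countᵇ p xs   ≡⟨ ≡.cong₂ (λ b m → (if b then 1 else 0) ℕ.+ m) (p≗q x)
                                                       (countᵇ-cong p q p≗q xs) ⟩
  (if q x then 1 else 0) ℕ.+ countᵇ q xs   ≡⟨ ≡.sym (countᵇ-∷ q x xs) ⟩
  countᵇ q (x ∷ xs)                        ∎
  where open ≡.≡-Reasoning

countᵇ-map : ∀ {A B : Set} (p : B → Bool) (f : A → B) xs → countᵇ p (map f xs) ≡ countᵇ (λ x → p (f x)) xs
countᵇ-map p f []       = ≡.refl
countᵇ-map p f (x ∷ xs) = ≡.trans (countᵇ-∷ p (f x) (map f xs))
  (≡.trans (≡.cong ((if p (f x) then 1 else 0) ℕ.+_) (countᵇ-map p f xs)) (≡.sym (countᵇ-∷ _ x xs)))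

countᵇ-false : ∀ {A : Set} (p : A → Bool) → (∀ x → p x ≡ false) → ∀ xs → countᵇ p xs ≡ 0
countᵇ-false p p≗false []       = ≡.refl
countᵇ-false p p≗false (x ∷ xs) = ≡.trans (countᵇ-∷ p x xs)
  (≡.cong₂ (λ b m → (if b then 1 else 0) ℕ.+ m) (p≗false x) (countᵇ-false p p≗false xs))

countᵇ-allFin : ∀ {k} (r : Fin k → Bool) → countᵇ r (allFin k) ≡ count r
countᵇ-allFin {zero}  r = ≡.refl
countᵇ-allFin {suc k} r = ≡.trans (countᵇ-∷ r fzero (map fsuc (allFin k)))
  (≡.cong ((if r fzero then 1 else 0) ℕ.+_) (≡.trans (countᵇ-map r fsuc (allFin k)) (countᵇ-allFin (λ i → r (fsuc i)))))

matchingSize-cong : ∀ G (M N : Fin (n G) → Fin (n G) → Bool) → (∀ u v → M u v ≡ N u v) →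
                    matchingSize G M ≡ matchingSize G N
matchingSize-cong G M N M≗N = ≡.cong sum (map-cong
  (λ u → countᵇ-cong _ _ (λ v → ≡.cong ((u <ꟳ v) ∧_) (M≗N u v)) (allFin (n G))) (allFin (n G)))

-- In `starMatching r` only the centre row contributes pairs u < v, one per
-- selected leaf.
matchingSize-starMatching : ∀ k (r : Fin k → Bool) → matchingSize (star k) (starMatching r) ≡ count r
matchingSize-starMatching k r = ≡.trans (≡.cong₂ ℕ._+_ centreContribution leafContributions) (ℕₚ.+-identityʳ (count r))
  where
  inRow : Fin (suc k) → Fin (suc k) → Bool
  inRow u v = (u <ꟳ v) ∧ starMatching r u v
  rowSize : Fin (suc k) → ℕ
  rowSize u = countᵇ (inRow u) (allFin (suc k))
  centreContribution : rowSize fzero ≡ count r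
  centreContribution = ≡.trans (countᵇ-∷ (inRow fzero) fzero (map fsuc (allFin k)))
    (≡.trans (countᵇ-map (inRow fzero) fsuc (allFin k)) (countᵇ-allFin r))
  leafRowEmpty : ∀ i → rowSize (fsuc i) ≡ 0
  leafRowEmpty i = countᵇ-false (inRow (fsuc i)) (λ { fzero → ≡.refl ; (fsuc j) → ∧-zeroʳ _ }) (allFin (suc k))
  leafContributions : sum (map rowSize (map fsuc (allFin k))) ≡ 0
  leafContributions = allZero (allFin k)
    where
    allZero : ∀ is → sum (map rowSize (map fsuc is)) ≡ 0
    allZero []       = ≡.refl
    allZero (i ∷ is) = ≡.cong₂ ℕ._+_ (leafRowEmpty i) (allZero is)

-- Finite sums and products over lists, in a commutative semiring.  They
-- are the folds `sumL`/`prodL` of Defs, so the lemmas apply to those.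

module FiniteSums {c ℓ : Level} (R : CommutativeSemiring c ℓ) where
  open CommutativeSemiring R
  open import Relation.Binary.Reasoning.Setoid setoid
  open import Algebra.Solver.Ring.NaturalCoefficients.Default R using (solve; _:+_; _:*_; _:=_)
  open import Algebra.Properties.Semiring.Mult semiring using () renaming (_×_ to _·_)

  ∑ : ∀ {A : Set} → (A → Carrier) → List A → Carrier
  ∑ f = foldr (λ x s → f x + s) 0#

  ∏ : ∀ {A : Set} → (A → Carrier) → List A → Carrier
  ∏ f = foldr (λ x s → f x * s) 1#

  ≡⇒≈ : ∀ {x y} → x ≡ y → x ≈ y
  ≡⇒≈ ≡.refl = refl

  ∑-cong : ∀ {A : Set} {f g : A → Carrier} (xs : List A) → (∀ x → f x ≈ g x) → ∑ f xs ≈ ∑ g xs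
  ∑-cong []       f≈g = refl
  ∑-cong (x ∷ xs) f≈g = +-cong (f≈g x) (∑-cong xs f≈g)

  ∑-zero : ∀ {A : Set} (xs : List A) → ∑ (λ _ → 0#) xs ≈ 0#
  ∑-zero []       = refl
  ∑-zero (x ∷ xs) = trans (+-cong refl (∑-zero xs)) (+-identityʳ 0#)

  ∑-+ : ∀ {A : Set} (f g : A → Carrier) (xs : List A) → ∑ (λ x → f x + g x) xs ≈ ∑ f xs + ∑ g xs
  ∑-+ f g []       = sym (+-identityʳ 0#)
  ∑-+ f g (x ∷ xs) = trans (+-cong refl (∑-+ f g xs))
    (solve 4 (λ p q r s → ((p :+ q) :+ (r :+ s)) := ((p :+ r) :+ (q :+ s))) refl (f x) (g x) (∑ f xs) (∑ g xs))

  ∑-*ˡ : ∀ {A : Set} (k : Carrier) (f : A → Carrier) (xs : List A) → ∑ (λ x → k * f x) xs ≈ k * ∑ f xs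
  ∑-*ˡ k f []       = sym (zeroʳ k)
  ∑-*ˡ k f (x ∷ xs) = trans (+-cong refl (∑-*ˡ k f xs)) (sym (distribˡ k (f x) (∑ f xs)))

  ∑-map : ∀ {A B : Set} (f : B → Carrier) (g : A → B) (xs : List A) → ∑ f (map g xs) ≡ ∑ (λ x → f (g x)) xs
  ∑-map f g []       = ≡.refl
  ∑-map f g (x ∷ xs) = ≡.cong (f (g x) +_) (∑-map f g xs)

  ∑-++ : ∀ {A : Set} (f : A → Carrier) (xs ys : List A) → ∑ f (xs ++ ys) ≈ ∑ f xs + ∑ f ys
  ∑-++ f []       ys = sym (+-identityˡ _)
  ∑-++ f (x ∷ xs) ys = trans (+-cong refl (∑-++ f xs ys)) (sym (+-assoc _ _ _))

  ∑-concatMap : ∀ {A B : Set} (f : B → Carrier) (h : A → List B) (xs : List A) →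
                ∑ f (concatMap h xs) ≈ ∑ (λ x → ∑ f (h x)) xs
  ∑-concatMap f h []       = refl
  ∑-concatMap f h (x ∷ xs) = trans (∑-++ f (h x) (concatMap h xs)) (+-cong refl (∑-concatMap f h xs))

  ∑-swap : ∀ {A B : Set} (f : A → B → Carrier) (xs : List A) (ys : List B) →
           ∑ (λ x → ∑ (f x) ys) xs ≈ ∑ (λ y → ∑ (λ x → f x y) xs) ys
  ∑-swap f []       ys = sym (∑-zero ys)
  ∑-swap f (x ∷ xs) ys = trans (+-cong refl (∑-swap f xs ys)) (sym (∑-+ (f x) (λ y → ∑ (λ x → f x y) xs) ys))

  if-cong : ∀ b {X Y : Carrier} → X ≈ Y → (if b then X else 0#) ≈ (if b then Y else 0#)
  if-cong true  X≈Y = X≈Y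
  if-cong false _   = refl

  ∑-if : ∀ {A : Set} b (g : A → Carrier) (ys : List A) → ∑ (λ y → if b then g y else 0#) ys ≈ (if b then ∑ g ys else 0#)
  ∑-if true  g ys = refl
  ∑-if false g ys = ∑-zero ys

  ∑-filter : ∀ {A : Set} (p : A → Bool) (f : A → Carrier) xs →
             ∑ f (filter (λ x → T? (p x)) xs) ≈ ∑ (λ x → if p x then f x else 0#) xs
  ∑-filter p f []       = refl
  ∑-filter p f (x ∷ xs) with p x
  ... | true  = +-cong refl (∑-filter p f xs)
  ... | false = trans (∑-filter p f xs) (sym (+-identityˡ _))

  ∑-allFuns : ∀ {A : Set} k (xs : List A) (g : (Fin (suc k) → A) → Carrier) →
              ∑ g (allFuns (suc k) xs) ≈ ∑ (λ x → ∑ (λ φ → g (consF x φ)) (allFuns k xs)) xs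
  ∑-allFuns k xs g = trans (∑-concatMap g (λ x → map (consF x) (allFuns k xs)) xs)
    (∑-cong xs (λ x → ≡⇒≈ (∑-map g (consF x) (allFuns k xs))))

  ∏-map : ∀ {A B : Set} (f : B → Carrier) (g : A → B) (xs : List A) → ∏ f (map g xs) ≡ ∏ (λ x → f (g x)) xs
  ∏-map f g []       = ≡.refl
  ∏-map f g (x ∷ xs) = ≡.cong (f (g x) *_) (∏-map f g xs)

  ∏-one : ∀ {A : Set} {f : A → Carrier} (xs : List A) → (∀ x → f x ≈ 1#) → ∏ f xs ≈ 1#
  ∏-one []       f≈1 = refl
  ∏-one (x ∷ xs) f≈1 = trans (*-cong (f≈1 x) (∏-one xs f≈1)) (*-identityʳ 1#)

  ∏-* : ∀ {A : Set} (f g : A → Carrier) (xs : List A) → ∏ (λ x → f x * g x) xs ≈ ∏ f xs * ∏ g xs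
  ∏-* f g []       = sym (*-identityʳ 1#)
  ∏-* f g (x ∷ xs) = trans (*-cong refl (∏-* f g xs))
    (solve 4 (λ p q r s → ((p :* q) :* (r :* s)) := ((p :* r) :* (q :* s))) refl (f x) (g x) (∏ f xs) (∏ g xs))

  -- The sifting property of a Kronecker delta: `xs` lists every element
  -- exactly once up to the Boolean equivalence E, so summing h against
  -- the indicator of "E-equal to y" picks out h y.
  Sifting : ∀ {A : Set} → List A → (A → A → Bool) → Set (c Level.⊔ ℓ)
  Sifting {A} xs E = ∀ (h : A → Carrier) → (∀ x y → T (E x y) → h x ≈ h y) →
                     ∀ y → ∑ (λ x → if E x y then h x else 0#) xs ≈ h y

  sifting-Bool : Sifting allBool _==_
  sifting-Bool h h-resp false = trans (+-cong refl (+-identityʳ 0#)) (+-identityʳ _)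
  sifting-Bool h h-resp true  = trans (+-identityˡ _) (+-identityʳ _)

  sifting-allFuns : ∀ {A : Set} {xs : List A} {E : A → A → Bool} → (∀ x → T (E x x)) → Sifting xs E →
                    ∀ k → Sifting (allFuns k xs) (pointwise E)
  sifting-allFuns E-refl sift zero h h-resp y = trans (+-identityʳ _) (h-resp _ y tt)
  sifting-allFuns {xs = xs} {E = E} E-refl sift (suc k) h h-resp y = begin
      ∑ (λ f → if pointwise E f y then h f else 0#) (allFuns (suc k) xs)
    ≈⟨ ∑-allFuns k xs _ ⟩
      ∑ (λ x → ∑ (λ ψ → if E x y₀ ∧ pointwise E ψ y₊ then h (consF x ψ) else 0#) (allFuns k xs)) xs
    ≈⟨ ∑-cong xs (λ x → trans (∑-cong (allFuns k xs) (λ ψ → ≡⇒≈ (if-∧ (E x y₀))))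
                               (∑-if (E x y₀) _ (allFuns k xs))) ⟩
      ∑ (λ x → if E x y₀ then ∑ (λ ψ → if pointwise E ψ y₊ then h (consF x ψ) else 0#) (allFuns k xs) else 0#) xs
    ≈⟨ ∑-cong xs (λ x → if-cong (E x y₀)
          (sifting-allFuns E-refl sift k (λ ψ → h (consF x ψ)) (λ ψ ψ′ t → h-resp _ _ (∧-pair (E-refl x) t)) y₊)) ⟩
      ∑ (λ x → if E x y₀ then h (consF x y₊) else 0#) xs
    ≈⟨ sift (λ x → h (consF x y₊)) (λ x x′ t → h-resp _ _ (∧-pair t (pointwise-refl E E-refl y₊))) y₀ ⟩
      h (consF y₀ y₊)
    ≈⟨ h-resp _ y (∧-pair (E-refl y₀) (pointwise-refl E E-refl y₊)) ⟩
      h y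
    ∎
    where
    y₀ = y fzero
    y₊ = λ i → y (fsuc i)

  sifting-Rows : ∀ k → Sifting (Rows k) sameRow
  sifting-Rows = sifting-allFuns {xs = allBool} {E = _==_} ==-refl sifting-Bool

  sifting-Matrices : ∀ k → Sifting (allFuns (suc k) (Rows (suc k))) sameMatrix
  sifting-Matrices k =
    sifting-allFuns {xs = Rows (suc k)} {E = sameRow} (pointwise-refl _==_ ==-refl) (sifting-Rows (suc k)) (suc k)

  -- Both split off
  -- the first entry: if it is selected, the remaining entries are not.
  ∑-noneᵇ : ∀ k (g : ℕ → Carrier) → ∑ (λ r → if noneᵇ r then g (count r) else 0#) (Rows k) ≈ g 0
  ∑-noneᵇ zero    g = +-identityʳ _
  ∑-noneᵇ (suc k) g = trans (∑-allFuns k allBool _)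
    (trans (+-cong (∑-noneᵇ k g) (trans (+-cong (∑-zero (Rows k)) refl) (+-identityʳ 0#))) (+-identityʳ _))

  ∑-atMostOne : ∀ k (g : ℕ → Carrier) → ∑ (λ r → if atMostOne r then g (count r) else 0#) (Rows k) ≈ g 0 + k · g 1
  ∑-atMostOne zero    g = refl
  ∑-atMostOne (suc k) g = trans (∑-allFuns k allBool _)
    (trans (+-cong (∑-atMostOne k g) (trans (+-cong (∑-noneᵇ k (λ m → g (suc m))) refl) (+-identityʳ _)))
      (solve 3 (λ x y z → ((x :+ z) :+ y) := (x :+ (y :+ z))) refl (g 0) (g 1) (k · g 1)))

-- Polynomials over a commutative ring as coefficient lists (constant term
-- first), with evaluation, the value p′(a) of the derivative at a fixed
-- point a, and multiplication by a linear factor X - x.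

module Polynomials {c ℓ : Level} (R : CommutativeRing c ℓ) (a : CommutativeRing.Carrier R) where
  open CommutativeRing R
  open import Relation.Binary.Reasoning.Setoid setoid
  open import Algebra.Solver.Ring.NaturalCoefficients.Default commutativeSemiring using (solve; _:+_; _:*_; _:=_)

  Poly : Set c
  Poly = List Carrier

  eval : Poly → Carrier → Carrier
  eval []      y = 0#
  eval (c ∷ p) y = c + y * eval p y

  -- For p = c + X·p₊ we have p′ = p₊ + X·p₊′, so p′(a) = p₊(a) + a·p₊′(a).
  deriv : Poly → Carrier
  deriv []      = 0#
  deriv (c ∷ p) = eval p a + a * deriv p

  eval-cong : ∀ p {y z} → y ≈ z → eval p y ≈ eval p z
  eval-cong []      y≈z = refl
  eval-cong (c ∷ p) y≈z = +-cong refl (*-cong y≈z (eval-cong p y≈z))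

  addConst : Carrier → Poly → Poly
  addConst c []      = c ∷ []
  addConst c (d ∷ p) = (c + d) ∷ p

  eval-addConst : ∀ c p y → eval (addConst c p) y ≈ c + eval p y
  eval-addConst c []      y = +-cong refl (zeroʳ y)
  eval-addConst c (d ∷ p) y = +-assoc c d _

  deriv-addConst : ∀ c p → deriv (addConst c p) ≈ deriv p
  deriv-addConst c []      = trans (+-identityˡ _) (zeroʳ a)
  deriv-addConst c (d ∷ p) = refl

  -- (X - x)·(c + X·p) = -x·c + X·(c + (X - x)·p)
  mulRoot : Carrier → Poly → Poly
  mulRoot x []      = []
  mulRoot x (c ∷ p) = ((- x) * c) ∷ addConst c (mulRoot x p)

  eval-mulRoot : ∀ x p y → eval (mulRoot x p) y ≈ (y - x) * eval p y
  eval-mulRoot x []      y = sym (zeroʳ _)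
  eval-mulRoot x (c ∷ p) y = begin
      (- x) * c + y * eval (addConst c (mulRoot x p)) y
    ≈⟨ +-cong refl (*-cong refl (trans (eval-addConst c (mulRoot x p) y) (+-cong refl (eval-mulRoot x p y)))) ⟩
      (- x) * c + y * (c + (y - x) * eval p y)
    ≈⟨ solve 4 (λ nx c y E → ((nx :* c) :+ y :* (c :+ (y :+ nx) :* E)) := ((y :+ nx) :* (c :+ y :* E)))
               refl (- x) c y (eval p y) ⟩
      (y - x) * (c + y * eval p y)
    ∎

  deriv-mulRoot : ∀ x p → deriv (mulRoot x p) ≈ eval p a + (a - x) * deriv p
  deriv-mulRoot x []      = sym (trans (+-identityˡ _) (zeroʳ _))
  deriv-mulRoot x (c ∷ p) = begin
      eval (addConst c (mulRoot x p)) a + a * deriv (addConst c (mulRoot x p))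
    ≈⟨ +-cong (trans (eval-addConst c (mulRoot x p) a) (+-cong refl (eval-mulRoot x p a)))
              (*-cong refl (trans (deriv-addConst c (mulRoot x p)) (deriv-mulRoot x p))) ⟩
      (c + (a - x) * eval p a) + a * (eval p a + (a - x) * deriv p)
    ≈⟨ solve 5 (λ c a nx E D → ((c :+ (a :+ nx) :* E) :+ a :* (E :+ (a :+ nx) :* D))
                             := ((c :+ a :* E) :+ (a :+ nx) :* (E :+ a :* D))) refl c a (- x) (eval p a) (deriv p) ⟩
      (c + a * eval p a) + (a - x) * (eval p a + a * deriv p)
    ∎

module _ {c ℓ : Level} (F : Field c ℓ) where
  open Field F
  open FiniteSums commutativeSemiring
  open import Relation.Binary.Reasoning.Setoid setoid
  open import Algebra.Properties.Ring ring using (xyx⁻¹≈y; x∙y⁻¹≈ε⇒x≈y; -0#≈0#; -‿distribˡ-*)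
  open import Algebra.Properties.Semiring.Mult semiring using (×-comm-*) renaming (_×_ to _·_)
  open import Algebra.Solver.Ring.NaturalCoefficients.Default commutativeSemiring using (solve; _:+_; _:*_; _:=_)

  ∑-∏-allFuns : ∀ {A : Set} (h : A → Carrier) (xs : List A) k →
                ∑ (λ ψ → ∏ (λ j → h (ψ j)) (allFin k)) (allFuns k xs) ≈ pow F (∑ h xs) k
  ∑-∏-allFuns h xs zero    = +-identityʳ 1#
  ∑-∏-allFuns h xs (suc k) = begin
      ∑ (λ ψ → ∏ (λ j → h (ψ j)) (allFin (suc k))) (allFuns (suc k) xs)
    ≈⟨ ∑-allFuns k xs _ ⟩
      ∑ (λ x → ∑ (λ φ → h x * ∏ (λ j → h (consF x φ j)) (map fsuc (allFin k))) (allFuns k xs)) xs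
    ≈⟨ ∑-cong xs (λ x → ∑-cong (allFuns k xs) (λ φ → *-cong refl (≡⇒≈ (∏-map _ fsuc (allFin k))))) ⟩
      ∑ (λ x → ∑ (λ φ → h x * ∏ (λ j → h (φ j)) (allFin k)) (allFuns k xs)) xs
    ≈⟨ ∑-cong xs (λ x → trans (∑-*ˡ (h x) _ (allFuns k xs)) (*-cong refl (∑-∏-allFuns h xs k))) ⟩
      ∑ (λ x → h x * pow F (∑ h xs) k) xs
    ≈⟨ ∑-cong xs (λ x → *-comm (h x) _) ⟩
      ∑ (λ x → pow F (∑ h xs) k * h x) xs
    ≈⟨ ∑-*ˡ _ h xs ⟩
      pow F (∑ h xs) k * ∑ h xs
    ≈⟨ *-comm _ _ ⟩
      pow F (∑ h xs) (suc k)
    ∎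

  -- Homomorphisms from a star: the centre goes to i, with weight α_i, and
  -- each leaf independently to some j, with weight α_j β_ij.
  module StarHomomorphisms (H : WeightedGraph F) where
    open WeightedGraph H

    degree : Fin q → Carrier
    degree i = ∑ (λ j → α j * β i j) (allFin q)

    edgeWeight : ∀ k → (Fin (suc k) → Fin q) → Fin (suc k) → Fin (suc k) → Carrier
    edgeWeight k φ u v = if (u <ꟳ v) ∧ starAdj u v then β (φ u) (φ v) else 1#

    weight : ∀ k → (Fin (suc k) → Fin q) → Carrier
    weight k φ = ∏ (λ u → α (φ u)) (allFin (suc k)) * ∏ (λ u → ∏ (edgeWeight k φ u) (allFin (suc k))) (allFin (suc k))

    -- Edges u < v of a star all start at the centre.
    leafRows-trivial : ∀ k φ → ∏ (λ u → ∏ (edgeWeight k φ u) (allFin (suc k))) (map fsuc (allFin k)) ≈ 1#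
    leafRows-trivial k φ = trans (≡⇒≈ (∏-map _ fsuc (allFin k))) (∏-one (allFin k) (λ i →
      trans (*-identityˡ _) (trans (≡⇒≈ (∏-map _ fsuc (allFin k)))
        (∏-one (allFin k) (λ j → ≡⇒≈ (≡.cong (λ b → if b then β (φ (fsuc i)) (φ (fsuc j)) else 1#)
                                               (∧-zeroʳ (fsuc i <ꟳ fsuc j))))))))

    weight-consF : ∀ k x (ψ : Fin k → Fin q) → weight k (consF x ψ) ≈ α x * ∏ (λ j → α (ψ j) * β x (ψ j)) (allFin k)
    weight-consF k x ψ = begin
        weight k (consF x ψ)
      ≈⟨ *-cong (*-cong refl (≡⇒≈ (∏-map _ fsuc (allFin k))))
                (*-cong (*-cong refl (≡⇒≈ (∏-map _ fsuc (allFin k)))) (leafRows-trivial k (consF x ψ))) ⟩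
        (α x * ∏ (λ j → α (ψ j)) (allFin k)) * ((1# * ∏ (λ j → β x (ψ j)) (allFin k)) * 1#)
      ≈⟨ *-cong refl (trans (*-identityʳ _) (*-identityˡ _)) ⟩
        (α x * ∏ (λ j → α (ψ j)) (allFin k)) * ∏ (λ j → β x (ψ j)) (allFin k)
      ≈⟨ *-assoc _ _ _ ⟩
        α x * (∏ (λ j → α (ψ j)) (allFin k) * ∏ (λ j → β x (ψ j)) (allFin k))
      ≈⟨ *-cong refl (sym (∏-* _ _ (allFin k))) ⟩
        α x * ∏ (λ j → α (ψ j) * β x (ψ j)) (allFin k)
      ∎

    hom-star : ∀ k → hom F (star k) H ≈ ∑ (λ i → α i * pow F (degree i) k) (allFin q)
    hom-star k = begin
        hom F (star k) H
      ≈⟨ ∑-allFuns k (allFin q) (weight k) ⟩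
        ∑ (λ x → ∑ (λ ψ → weight k (consF x ψ)) (allFuns k (allFin q))) (allFin q)
      ≈⟨ ∑-cong (allFin q) (λ x → ∑-cong (allFuns k (allFin q)) (weight-consF k x)) ⟩
        ∑ (λ x → ∑ (λ ψ → α x * ∏ (λ j → α (ψ j) * β x (ψ j)) (allFin k)) (allFuns k (allFin q))) (allFin q)
      ≈⟨ ∑-cong (allFin q) (λ x → trans (∑-*ˡ (α x) _ (allFuns k (allFin q)))
            (*-cong refl (∑-∏-allFuns (λ j → α j * β x j) (allFin q) k))) ⟩
        ∑ (λ i → α i * pow F (degree i) k) (allFin q)
      ∎

  -- wm_a(K_{1,k}) = a^{k+1} + k·a^{k-1}: the empty matching and the k
  -- single edges.
  module StarMatchings (a : Carrier) where

    starValue : ℕ → Carrier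
    starValue k = pow F a (suc k) + k · pow F a (k ∸ 1)

    module _ (k : ℕ) where
      sizeWeight : ℕ → Carrier
      sizeWeight m = pow F a (suc k ∸ 2 ℕ.* m)

      matchingWeight : StarMatrix k → Carrier
      matchingWeight M = sizeWeight (matchingSize (star k) M)

      Matrices : List (StarMatrix k)
      Matrices = allFuns (suc k) (Rows (suc k))

      matchingWeight-resp : ∀ M N → T (sameMatrix M N) → matchingWeight M ≈ matchingWeight N
      matchingWeight-resp M N t = ≡⇒≈ (≡.cong sizeWeight (matchingSize-cong (star k) M N (sameMatrix-elim M N t)))

      matchingIndicator : ∀ M →
        (if isMatching (star k) M then matchingWeight M else 0#) ≈
        ∑ (λ r → if sameMatrix M (starMatching r) then (if atMostOne r then matchingWeight M else 0#) else 0#) (Rows k)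
      matchingIndicator M = begin
          (if isMatching (star k) M then w else 0#)
        ≡⟨ ≡.cong (λ b → if b then w else 0#) (isMatching-star k M) ⟩
          (if shaped ∧ atMostOne r₀ then w else 0#)
        ≡⟨ if-∧ shaped ⟩
          h r₀
        ≈⟨ sym (sifting-Rows k h h-resp r₀) ⟩
          ∑ (λ r → if sameRow r r₀ then h r else 0#) (Rows k)
        ≈⟨ ∑-cong (Rows k) (λ r → ≡⇒≈ (≡.trans (≡.sym (if-∧ (sameRow r r₀)))
              (≡.cong (λ b → if b then (if atMostOne r then w else 0#) else 0#) (≡.sym (sameMatrix-starMatching M r))))) ⟩
          ∑ (λ r → if sameMatrix M (starMatching r) then (if atMostOne r then w else 0#) else 0#) (Rows k)
        ∎
        where
        w = matchingWeight M
        r₀ = centreRow M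
        shaped = sameMatrix M (starMatching r₀)
        h : (Fin k → Bool) → Carrier
        h r = if shaped then (if atMostOne r then w else 0#) else 0#
        h-resp : ∀ r s → T (sameRow r s) → h r ≈ h s
        h-resp r s t = ≡⇒≈ (≡.cong (λ b → if shaped then (if b then w else 0#) else 0#)
                                    (atMostOne-cong r s (sameRow-elim r s t)))

      wm-star-rows : wm F a (star k) ≈ ∑ (λ r → if atMostOne r then sizeWeight (count r) else 0#) (Rows k)
      wm-star-rows = begin
          wm F a (star k)
        ≈⟨ ∑-filter (isMatching (star k)) matchingWeight Matrices ⟩
          ∑ (λ M → if isMatching (star k) M then matchingWeight M else 0#) Matrices
        ≈⟨ ∑-cong Matrices matchingIndicator ⟩
          ∑ (λ M → ∑ (λ r → if sameMatrix M (starMatching r) then term r M else 0#) (Rows k)) Matrices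
        ≈⟨ ∑-swap _ Matrices (Rows k) ⟩
          ∑ (λ r → ∑ (λ M → if sameMatrix M (starMatching r) then term r M else 0#) Matrices) (Rows k)
        ≈⟨ ∑-cong (Rows k) (λ r → sifting-Matrices k (term r) (λ M N t → if-cong (atMostOne r) (matchingWeight-resp M N t))
                                                     (starMatching r)) ⟩
          ∑ (λ r → term r (starMatching r)) (Rows k)
        ≈⟨ ∑-cong (Rows k) (λ r → if-cong (atMostOne r) (≡⇒≈ (≡.cong sizeWeight (matchingSize-starMatching k r)))) ⟩
          ∑ (λ r → if atMostOne r then sizeWeight (count r) else 0#) (Rows k)
        ∎
        where
        term : (Fin k → Bool) → StarMatrix k → Carrier
        term r M = if atMostOne r then matchingWeight M else 0#

    wm-star : ∀ k → wm F a (star k) ≈ starValue k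
    wm-star k = trans (wm-star-rows k) (∑-atMostOne k (sizeWeight k))

  *-nonzero : ∀ {d e} → ¬ d ≈ 0# → ¬ e ≈ 0# → ¬ (d * e) ≈ 0#
  *-nonzero {d} {e} d≉0 e≉0 de≈0 with inverse e e≉0
  ... | e⁻¹ , ee⁻¹≈1 = d≉0 (begin
      d              ≈⟨ sym (*-identityʳ d) ⟩
      d * 1#         ≈⟨ *-cong refl (sym ee⁻¹≈1) ⟩
      d * (e * e⁻¹)  ≈⟨ sym (*-assoc _ _ _) ⟩
      (d * e) * e⁻¹  ≈⟨ *-cong de≈0 refl ⟩
      0# * e⁻¹       ≈⟨ zeroˡ e⁻¹ ⟩
      0#             ∎)

  module _ (a : Carrier) where
    open Polynomials commutativeRing a
    open StarMatchings a using (starValue)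

    -- The key algebraic fact: for finitely many points x_i and weights w_i,
    -- the functional p ↦ ∑ w_i p(x_i) is never p ↦ b·p(a) + d·p′(a) with
    -- d ≠ 0.  By induction on the points: a point x_i = a is absorbed into
    -- b, and a point x_i ≠ a is removed by testing against (X - x_i)·p,
    -- which rescales d by a - x_i ≠ 0.  With no points left, p = X - a
    -- gives 0 = d.  Whether x_i = a is decided under a double negation,
    -- which suffices since the conclusion is a negation.
    derivative-not-evaluations : ∀ {I : Set} (x : I → Carrier) (l : List I) (w : I → Carrier) (b d : Carrier) →
      ¬ d ≈ 0# → ¬ (∀ p → ∑ (λ i → w i * eval p (x i)) l ≈ b * eval p a + d * deriv p)
    derivative-not-evaluations x [] w b d d≉0 h = d≉0 (begin
        d                                  ≈⟨ sym (+-identityˡ d) ⟩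
        0# + d                             ≈⟨ +-cong (sym (zeroʳ b)) (sym (*-identityʳ d)) ⟩
        b * 0# + d * 1#                    ≈⟨ +-cong (*-cong refl (sym eval-X-a)) (*-cong refl (sym deriv-X-a)) ⟩
        b * eval X-a a + d * deriv X-a     ≈⟨ sym (h X-a) ⟩
        0#                                 ∎)
      where
      X-a : Poly
      X-a = (- a) ∷ 1# ∷ []
      eval-X-a : eval X-a a ≈ 0#
      eval-X-a = trans (+-cong refl (trans (*-cong refl (trans (+-cong refl (zeroʳ a)) (+-identityʳ 1#))) (*-identityʳ a)))
                       (-‿inverseˡ a)
      deriv-X-a : deriv X-a ≈ 1#
      deriv-X-a = trans (+-cong (trans (+-cong refl (zeroʳ a)) (+-identityʳ 1#))
                                (trans (*-cong refl (trans (+-identityˡ _) (zeroʳ a))) (zeroʳ a)))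
                        (+-identityʳ 1#)
    derivative-not-evaluations x (i ∷ l) w b d d≉0 h = ¬¬-excluded-middle λ where
        (yes xᵢ≈a) → derivative-not-evaluations x l w (b - w i) d d≉0 (absorb xᵢ≈a)
        (no xᵢ≉a)  → derivative-not-evaluations x l (λ j → w j * (x j - x i)) (b * (a - x i) + d) (d * (a - x i))
                       (*-nonzero d≉0 (λ a-xᵢ≈0 → xᵢ≉a (sym (x∙y⁻¹≈ε⇒x≈y a (x i) a-xᵢ≈0)))) eliminate
      where
      rest : Poly → Carrier
      rest p = ∑ (λ j → w j * eval p (x j)) l
      rest≈ : ∀ p → rest p ≈ (b * eval p a + d * deriv p) - w i * eval p (x i)
      rest≈ p = trans (sym (xyx⁻¹≈y (w i * eval p (x i)) (rest p))) (+-cong (h p) refl)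
      absorb : x i ≈ a → ∀ p → rest p ≈ (b - w i) * eval p a + d * deriv p
      absorb xᵢ≈a p = begin
          rest p
        ≈⟨ rest≈ p ⟩
          (b * eval p a + d * deriv p) - w i * eval p (x i)
        ≈⟨ +-cong refl (trans (-‿cong (*-cong refl (eval-cong p xᵢ≈a))) (-‿distribˡ-* (w i) (eval p a))) ⟩
          (b * eval p a + d * deriv p) + (- w i) * eval p a
        ≈⟨ solve 5 (λ b E d D nW → ((b :* E :+ d :* D) :+ (nW :* E)) := ((b :+ nW) :* E :+ d :* D))
                   refl b (eval p a) d (deriv p) (- w i) ⟩
          (b - w i) * eval p a + d * deriv p
        ∎
      eliminate : ∀ p → ∑ (λ j → (w j * (x j - x i)) * eval p (x j)) l
                        ≈ (b * (a - x i) + d) * eval p a + (d * (a - x i)) * deriv p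
      eliminate p = begin
          ∑ (λ j → (w j * (x j - x i)) * eval p (x j)) l
        ≈⟨ ∑-cong l (λ j → trans (*-assoc _ _ _) (*-cong refl (sym (eval-mulRoot (x i) p (x j))))) ⟩
          rest p′
        ≈⟨ rest≈ p′ ⟩
          (b * eval p′ a + d * deriv p′) - w i * eval p′ (x i)
        ≈⟨ +-cong (+-cong (*-cong refl (eval-mulRoot (x i) p a)) (*-cong refl (deriv-mulRoot (x i) p))) vanishes ⟩
          (b * ((a - x i) * eval p a) + d * (eval p a + (a - x i) * deriv p)) + 0#
        ≈⟨ +-identityʳ _ ⟩
          b * ((a - x i) * eval p a) + d * (eval p a + (a - x i) * deriv p)
        ≈⟨ solve 5 (λ b t E d D → (b :* (t :* E) :+ d :* (E :+ t :* D)) := ((b :* t :+ d) :* E :+ (d :* t) :* D))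
                   refl b (a - x i) (eval p a) d (deriv p) ⟩
          (b * (a - x i) + d) * eval p a + (d * (a - x i)) * deriv p
        ∎
        where
        p′ = mulRoot (x i) p
        vanishes : - (w i * eval p′ (x i)) ≈ 0#
        vanishes = trans (-‿cong (trans (*-cong refl (trans (eval-mulRoot (x i) p (x i))
                                                            (trans (*-cong (-‿inverseʳ (x i)) refl) (zeroˡ _))))
                                       (zeroʳ _)))
                         -0#≈0#

    multiple-suc : ∀ m → (suc m) · pow F a m ≈ pow F a m + a * (m · pow F a (m ∸ 1))
    multiple-suc zero    = +-cong refl (sym (zeroʳ a))
    multiple-suc (suc m) = +-cong refl (sym (×-comm-* (suc m) a (pow F a m)))

    -- ∑ₖ cₖ·starValue (m + k) for p = ∑ₖ cₖ Xᵏ.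
    shiftedValue : Poly → ℕ → Carrier
    shiftedValue []      m = 0#
    shiftedValue (c ∷ p) m = c * starValue m + shiftedValue p (suc m)

    shiftedValue-closed : ∀ p m → shiftedValue p m ≈ starValue m * eval p a + pow F a m * deriv p
    shiftedValue-closed []      m = sym (trans (+-cong (zeroʳ _) (zeroʳ _)) (+-identityˡ 0#))
    shiftedValue-closed (c ∷ p) m = begin
        c * starValue m + shiftedValue p (suc m)
      ≈⟨ +-cong refl (shiftedValue-closed p (suc m)) ⟩
        c * (a * A + V) + ((a * (a * A) + (suc m) · A) * E + (a * A) * D)
      ≈⟨ +-cong refl (+-cong (*-cong (+-cong refl (multiple-suc m)) refl) refl) ⟩
        c * (a * A + V) + ((a * (a * A) + (A + a * V)) * E + (a * A) * D)
      ≈⟨ solve 6 (λ c a A V E D → (c :* (a :* A :+ V) :+ ((a :* (a :* A) :+ (A :+ a :* V)) :* E :+ (a :* A) :* D))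
                                 := ((a :* A :+ V) :* (c :+ a :* E) :+ A :* (E :+ a :* D)))
                 refl c a A V E D ⟩
        starValue m * eval (c ∷ p) a + A * deriv (c ∷ p)
      ∎
      where
      A = pow F a m
      V = m · pow F a (m ∸ 1)
      E = eval p a
      D = deriv p

    moments⇒functional : ∀ {I : Set} (x w : I → Carrier) (l : List I) →
      (∀ m → ∑ (λ i → w i * pow F (x i) m) l ≈ starValue m) →
      ∀ p → ∑ (λ i → w i * eval p (x i)) l ≈ a * eval p a + 1# * deriv p
    moments⇒functional x w l moments p = begin
        ∑ (λ i → w i * eval p (x i)) l
      ≈⟨ ∑-cong l (λ i → *-cong refl (sym (*-identityˡ _))) ⟩
        ∑ (λ i → w i * (pow F (x i) 0 * eval p (x i))) l
      ≈⟨ shifted p 0 ⟩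
        shiftedValue p 0
      ≈⟨ shiftedValue-closed p 0 ⟩
        starValue 0 * eval p a + 1# * deriv p
      ≈⟨ +-cong (*-cong (trans (+-identityʳ _) (*-identityʳ a)) refl) refl ⟩
        a * eval p a + 1# * deriv p
      ∎
      where
      shifted : ∀ p m → ∑ (λ i → w i * (pow F (x i) m * eval p (x i))) l ≈ shiftedValue p m
      shifted []      m = trans (∑-cong l (λ i → trans (*-cong refl (zeroʳ _)) (zeroʳ _))) (∑-zero l)
      shifted (c ∷ p) m = begin
          ∑ (λ i → w i * (pow F (x i) m * (c + x i * eval p (x i)))) l
        ≈⟨ ∑-cong l (λ i → solve 5 (λ W A c X E → (W :* (A :* (c :+ X :* E))) := (c :* (W :* A) :+ W :* ((X :* A) :* E)))
                                     refl (w i) (pow F (x i) m) c (x i) (eval p (x i))) ⟩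
          ∑ (λ i → c * (w i * pow F (x i) m) + w i * (pow F (x i) (suc m) * eval p (x i))) l
        ≈⟨ ∑-+ _ _ l ⟩
          ∑ (λ i → c * (w i * pow F (x i) m)) l + ∑ (λ i → w i * (pow F (x i) (suc m) * eval p (x i))) l
        ≈⟨ +-cong (trans (∑-*ˡ c _ l) (*-cong refl (moments m))) (shifted p (suc m)) ⟩
          shiftedValue (c ∷ p) m
        ∎

theorem4p4 : ∀ {c ℓ : Level} (F : Field c ℓ) (a : Field.Carrier F) → ¬ Σ (WeightedGraph F) (λ H → ∀ (G : SimpleGraph) → Field._≈_ F (wm F a G) (hom F G H))
theorem4p4 F a (H , wm≈hom) =
  derivative-not-evaluations F a degree (allFin q) α a 1# 1≉0 (moments⇒functional F a degree α (allFin q) moments)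
  where
  open Field F
  open WeightedGraph H
  open StarHomomorphisms F H
  open FiniteSums commutativeSemiring using (∑)
  open StarMatchings F a using (starValue; wm-star)
  moments : ∀ m → ∑ (λ i → α i * pow F (degree i) m) (allFin q) ≈ starValue m
  moments m = trans (sym (hom-star m)) (trans (sym (wm≈hom (star m))) (wm-star m))
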